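{- Let $k\ge 3$ be an integer and let $G^5_k(p,q)$ be the graph defined below. Then: (i) $\chi(G^5_k(p,q))=k+1$, and in every proper $(k+1)$-coloring of $G^5_k(p,q)$ the vertices $p$ and $q$ receive distinct colors; (ii) for every $\alpha,\beta\in\{1,\dots,k+1\}$ with $\alpha\ne\beta$, there exists a $(p,\alpha)$-connected greedy coloring of $G^5_k(p,q)$ in which $q$ is colored $\beta$, and a $(q,\beta)$-connected greedy coloring of $G^5_k(p,q)$ in which $p$ is colored $\alpha$.
   Context: $G^5_k(p,q)$ is constructed as follows: take an induced path $(p,x,y,z)$, a clique $P$ of size $k-1$ and a clique $Q$ of size $k$, all disjoint; make each of $p,x,y,z$ adjacent to all vertices of $P$; make $z$ adjacent to all vertices of $Q$; finally add a vertex $q$ adjacent to all vertices of $Q$ (no other edges). A connected ordering is an ordering $(v_1,\dots,v_n)$ of the vertices in which each $v_i$, $i\ge 2$, has a neighbour among $v_1,\dots,v_{i-1}$. Given a vertex $s$ and positive integer $\alpha$, an $(s,\alpha)$-connected greedy coloring is a coloring obtained from some connected ordering starting with $s$ by coloring $s$ with $\alpha$ and then coloring each subsequent vertex with the smallest positive integer not used on its already-coloured neighbours. -}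

module Defs where

open import Data.Nat using (ℕ; _∸_; _≤_; _<_; suc)
open import Data.Fin using (Fin)
open import Data.Product using (Σ; ∃; _×_; _,_)
open import Data.Sum using (_⊎_)
open import Data.Unit using (⊤)
open import Data.Empty using (⊥)
open import Data.List using (List; []; _∷_)
open import Data.List.Membership.Propositional using (_∈_)
open import Data.List.Relation.Unary.Any using (Any)
open import Data.List.Relation.Unary.Unique.Propositional using (Unique)
open import Relation.Nullary using (¬_)
open import Relation.Binary.PropositionalEquality using (_≡_; _≢_)

module _ {V : Set} (Adj : V → V → Set) where

  Proper : {m : ℕ} → (V → Fin m) → Set
  Proper c = ∀ u v → Adj u v → c u ≢ c v

  Colorable : ℕ → Set
  Colorable m = Σ (V → Fin m) Proper

  ChromaticNumber : ℕ → Set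
  ChromaticNumber m = Colorable m × (∀ m' → m' < m → ¬ Colorable m')

  -- `pre` is the list of already-placed vertices (in any order),
  -- `rest` the remaining part of the ordering: every vertex has a
  -- neighbour among the earlier ones.
  ConnectedFrom : List V → List V → Set
  ConnectedFrom pre []         = ⊤
  ConnectedFrom pre (v ∷ rest) = Any (Adj v) pre × ConnectedFrom (v ∷ pre) rest

  ConnectedOrderingFrom : V → List V → Set
  ConnectedOrderingFrom s []         = ⊥
  ConnectedOrderingFrom s (v ∷ rest) =
    (v ≡ s) × Unique (v ∷ rest) × (∀ u → u ∈ (v ∷ rest)) × ConnectedFrom (v ∷ []) rest

  GreedyStep : (V → ℕ) → List V → V → Set
  GreedyStep c pre v =
    1 ≤ c v
    × (∀ u → u ∈ pre → Adj v u → c u ≢ c v)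
    × (∀ j → 1 ≤ j → j < c v → ∃ λ u → u ∈ pre × Adj v u × c u ≡ j)

  GreedyFrom : (V → ℕ) → List V → List V → Set
  GreedyFrom c pre []         = ⊤
  GreedyFrom c pre (v ∷ rest) = GreedyStep c pre v × GreedyFrom c (v ∷ pre) rest

  ConnectedGreedyColoring : V → ℕ → (V → ℕ) → Set
  ConnectedGreedyColoring s α c =
    ∃ λ rest → ConnectedOrderingFrom s (s ∷ rest) × c s ≡ α × GreedyFrom c (s ∷ []) rest

data V5 (k : ℕ) : Set where
  vp vx vy vz vq : V5 k
  vP : Fin (k ∸ 1) → V5 k
  vQ : Fin k → V5 k

data Edge5 (k : ℕ) : V5 k → V5 k → Set where
  px : Edge5 k vp vx
  xy : Edge5 k vx vy
  yz : Edge5 k vy vz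
  pP : ∀ i → Edge5 k vp (vP i)
  xP : ∀ i → Edge5 k vx (vP i)
  yP : ∀ i → Edge5 k vy (vP i)
  zP : ∀ i → Edge5 k vz (vP i)
  PP : ∀ {i j} → i ≢ j → Edge5 k (vP i) (vP j)
  QQ : ∀ {i j} → i ≢ j → Edge5 k (vQ i) (vQ j)
  zQ : ∀ i → Edge5 k vz (vQ i)
  qQ : ∀ i → Edge5 k vq (vQ i)

Adj5 : (k : ℕ) → V5 k → V5 k → Set
Adj5 k u v = Edge5 k u v ⊎ Edge5 k v u

module Submission where

open import Defs
open import Data.Nat as ℕ using (ℕ; zero; suc; _≤_; _∸_; z≤n; s≤s; z<s; s<s)
open import Data.Fin as Fin using (Fin; toℕ; fromℕ<; punchIn; punchOut)
open import Data.Fin.Properties using (toℕ-fromℕ<; toℕ-injective; toℕ<n; injective⇒≤; _≟_;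
  punchIn-injective; punchInᵢ≢i; punchIn-punchOut; <-irrefl; <-asym; <-trans; <-cmp)
open import Data.Vec.Functional using () renaming (_∷_ to _◂_)
open import Function using (_∘_)
open import Function.Definitions using (Injective)
import Data.Nat.Properties as ℕₚ
open import Data.Product using (∃; _×_; _,_; proj₁; proj₂)
open import Data.Sum using (_⊎_; inj₁; inj₂; swap)
open import Data.Unit using (⊤; tt)
open import Data.Empty using (⊥)
open import Data.Empty using (⊥-elim)
open import Data.List using (List; []; _∷_; _++_; map; allFin)
open import Data.List.Membership.Propositional.Properties using (∈-map⁺; ∈-map⁻; ∈-++⁺ˡ; ∈-++⁺ʳ; ∈-++⁻; ∈-allFin)
import Data.List.Relation.Unary.Unique.Propositional.Properties as Unique
open import Data.List.Membership.Propositional using (_∈_)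
open import Data.List.Relation.Unary.Any using (Any; here; there)
open import Data.List.Relation.Unary.All as All using (All; []; _∷_)
open import Data.List.Relation.Unary.AllPairs using (AllPairs; []; _∷_)
open import Data.List.Relation.Unary.Linked.Properties using (Linked⇒AllPairs)
open import Data.List.Relation.Unary.Unique.Propositional using (Unique)
open import Data.List.Relation.Binary.Permutation.Propositional using (↭-sym; ↭⇒↭ₛ)
open import Data.List.Relation.Binary.Permutation.Propositional.Properties using (∈-resp-↭)
import Data.List.Relation.Binary.Permutation.Setoid.Properties as PermProps
import Data.List.Sort as Sort
open import Level using (0ℓ)
open import Relation.Binary.Definitions using (tri<; tri≈; tri>)
open import Relation.Binary.Bundles using (StrictTotalOrder; DecTotalOrder)
open import Data.Product.Relation.Binary.Lex.Strict using (×-strictTotalOrder)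
import Relation.Binary.Construct.On as On
import Relation.Binary.Properties.StrictTotalOrder as StrictTotalOrderProperties
open import Relation.Binary.PropositionalEquality using (_≡_; _≢_; refl; sym; trans; cong; subst; setoid; module ≡-Reasoning)
open import Relation.Nullary using (¬_; yes; no)

-- Part (i).  z together with the k-clique Q is a (k+1)-clique, so k+1 colours are needed; the
-- colourings built for part (ii) use exactly k+1.  In a proper (k+1)-colouring two common neighbours
-- of a k-clique must both take the one colour the clique misses: applied to Q this gives c q = c z,
-- applied to the clique {y} ∪ P it gives c x = c z, and since p ~ x we get c p ≠ c q.
--
-- For distinct colours a, b we fix one proper colouring: p, y get a; x, z, q get b;
-- Q gets the colours other than b and P those other than a and b, both in increasing order
-- (by punching b, resp. a and b, into the palette).  A proper colouring is the connected greedy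
-- colouring of any ordering in which every vertex after the source has an earlier neighbour and,
-- for each smaller colour, an earlier neighbour of that colour.  We produce such orderings by
-- sorting the vertices according to a rank (block, level, offset), where the level of a clique
-- vertex is its colour; one rank function for each source (p or q) and each order of a and b.
-- The hypothesis k ≥ 3 is used only to know that P is non-empty.

fin-below : ∀ {m} (g : Fin m) {j} → j ℕ.< toℕ g → ∃ λ f → f Fin.< g × toℕ f ≡ j
fin-below g j<g = fromℕ< (ℕₚ.<-trans j<g (toℕ<n g)) ,
                  subst (ℕ._< toℕ g) (sym (toℕ-fromℕ< _)) j<g , toℕ-fromℕ< _

◂-injective : ∀ {A : Set} {n} {x : A} {f : Fin n → A} → (∀ i → x ≢ f i) → Injective _≡_ _≡_ f →
              Injective _≡_ _≡_ (x ◂ f)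
◂-injective {x = x} {f} new inj {i} {j} = go i j
  where
  go : ∀ i j → (x ◂ f) i ≡ (x ◂ f) j → i ≡ j
  go Fin.zero Fin.zero _ = refl
  go Fin.zero (Fin.suc j) e = ⊥-elim (new j e)
  go (Fin.suc i) Fin.zero e = ⊥-elim (new i (sym e))
  go (Fin.suc i) (Fin.suc j) e = cong Fin.suc (inj e)

module GreedyByRank {V : Set} (Adj : V → V → Set) {m : ℕ} (colour : V → Fin m)
                    {r ℓ₁ ℓ₂} (R : StrictTotalOrder r ℓ₁ ℓ₂) (rank : V → StrictTotalOrder.Carrier R) where

  open StrictTotalOrder R using (irrefl; asym) renaming (_<_ to _≺_; module Eq to ≈)

  greedyColour : V → ℕ
  greedyColour v = suc (toℕ (colour v))

  EarlierNeighbour : V → V → Set ℓ₂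
  EarlierNeighbour v u = Adj v u × rank u ≺ rank v

  Witness : V → Fin m → Set ℓ₂
  Witness v f = ∃ λ u → EarlierNeighbour v u × colour u ≡ f

  Supported : V → Set ℓ₂
  Supported v = (∀ f → f Fin.< colour v → Witness v f) × ∃ (EarlierNeighbour v)

  private
    byRank : DecTotalOrder _ _ _
    byRank = On.decTotalOrder (StrictTotalOrderProperties.decTotalOrder R) rank
  open Sort byRank using (sort; sort-↭; sort-↗)
  open DecTotalOrder byRank using () renaming (_≤_ to _≼_; trans to ≼-trans)

  ≼⇒⊀ : ∀ {u v} → v ≼ u → ¬ (rank u ≺ rank v)
  ≼⇒⊀ (inj₁ v≺u) u≺v = asym u≺v v≺u
  ≼⇒⊀ (inj₂ v≈u) u≺v = irrefl (≈.sym v≈u) u≺v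

  -- a vertex ranked below v is not v and not in a rest ranked at least rank v, so it was already placed
  earlier-placed : ∀ {pre v rest u} → (∀ w → w ∈ pre ⊎ w ∈ v ∷ rest) → All (v ≼_) rest →
                   rank u ≺ rank v → u ∈ pre
  earlier-placed {u = u} covers v≼rest u≺v with covers u
  ... | inj₁ u∈pre = u∈pre
  ... | inj₂ (here refl) = ⊥-elim (irrefl ≈.refl u≺v)
  ... | inj₂ (there u∈rest) = ⊥-elim (≼⇒⊀ (All.lookup v≼rest u∈rest) u≺v)

  greedy-step : Proper Adj colour → ∀ {pre v} → (∀ {u} → rank u ≺ rank v → u ∈ pre) → Supported v →
                GreedyStep Adj greedyColour pre v × Any (Adj v) pre
  greedy-step proper {pre} {v} placed (smaller , u , adj , u≺v) =
    (s≤s z≤n , distinct , witness) , Any-of (placed u≺v) adj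
    where
    Any-of : ∀ {w ws} → w ∈ ws → Adj v w → Any (Adj v) ws
    Any-of (here refl) a = here a
    Any-of (there w∈ws) a = there (Any-of w∈ws a)
    distinct : ∀ w → w ∈ pre → Adj v w → greedyColour w ≢ greedyColour v
    distinct w _ a e = proper v w a (sym (toℕ-injective (ℕₚ.suc-injective e)))
    witness : ∀ j → 1 ≤ j → j ℕ.< greedyColour v →
              ∃ λ w → w ∈ pre × Adj v w × greedyColour w ≡ j
    witness (suc j) _ (s≤s j<v) with fin-below (colour v) j<v
    ... | f , f<v , f≡j with smaller f f<v
    ...   | w , (a , w≺v) , e = w , placed w≺v , a , cong suc (trans (cong toℕ e) f≡j)

  advance : ∀ {pre rest : List V} {v : V} → (∀ w → w ∈ pre ⊎ w ∈ v ∷ rest) → ∀ w → w ∈ v ∷ pre ⊎ w ∈ rest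
  advance covers w with covers w
  ... | inj₁ w∈pre = inj₁ (there w∈pre)
  ... | inj₂ (here w≡v) = inj₁ (here w≡v)
  ... | inj₂ (there w∈rest) = inj₂ w∈rest

  run : Proper Adj colour → ∀ pre rest → AllPairs _≼_ rest → (∀ w → w ∈ pre ⊎ w ∈ rest) →
        All Supported rest → GreedyFrom Adj greedyColour pre rest × ConnectedFrom Adj pre rest
  run proper pre [] _ _ _ = tt , tt
  run proper pre (v ∷ rest) (v≼rest ∷ sorted) covers (sup ∷ sups) =
    (proj₁ step , proj₁ later) , (proj₂ step , proj₂ later)
    where
    step : GreedyStep Adj greedyColour pre v × Any (Adj v) pre
    step = greedy-step proper (earlier-placed covers v≼rest) sup
    later : GreedyFrom Adj greedyColour (v ∷ pre) rest × ConnectedFrom Adj (v ∷ pre) rest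
    later = run proper (v ∷ pre) rest sorted (advance covers) sups

  others-supported : ∀ {s : V} {rest} → All (s ≢_) rest → (∀ v → v ≡ s ⊎ Supported v) →
                     All Supported rest
  others-supported {rest = rest} s∉rest supported = All.tabulate supported-in-rest
    where
    supported-in-rest : ∀ {v} → v ∈ rest → Supported v
    supported-in-rest {v} v∈rest with supported v
    ... | inj₁ refl = ⊥-elim (All.lookup s∉rest v∈rest refl)
    ... | inj₂ sup = sup

  greedy-along : Proper Adj colour → ∀ s ws → Unique ws → (∀ u → u ∈ ws) → AllPairs _≼_ ws →
                 (∀ v → v ≡ s ⊎ Supported v) → ConnectedGreedyColoring Adj s (greedyColour s) greedyColour
  greedy-along proper s [] _ complete _ _ with complete s
  ... | ()
  greedy-along proper s (h ∷ rest) (h∉rest ∷ unique) complete (h≼rest ∷ sorted) supported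
    with supported h
  ... | inj₂ (_ , u , _ , u≺h) with complete u
  ...   | here refl = ⊥-elim (irrefl ≈.refl u≺h)
  ...   | there u∈rest = ⊥-elim (≼⇒⊀ (All.lookup h≼rest u∈rest) u≺h)
  greedy-along proper s (s ∷ rest) (s∉rest ∷ unique) complete (_ ∷ sorted) supported
    | inj₁ refl =
    rest , (refl , s∉rest ∷ unique , complete , proj₂ coloured) , refl , proj₁ coloured
    where
    coloured : GreedyFrom Adj greedyColour (s ∷ []) rest × ConnectedFrom Adj (s ∷ []) rest
    coloured = run proper (s ∷ []) rest sorted (advance (inj₂ ∘ complete))
                   (others-supported s∉rest supported)

  greedy-by-rank : Proper Adj colour → ∀ s vs → Unique vs → (∀ u → u ∈ vs) →
                   (∀ v → v ≡ s ⊎ Supported v) → ConnectedGreedyColoring Adj s (greedyColour s) greedyColour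
  greedy-by-rank proper s vs unique complete =
    greedy-along proper s (sort vs)
      (PermProps.Unique-resp-↭ (setoid V) (↭⇒↭ₛ (↭-sym (sort-↭ vs))) unique)
      (λ u → ∈-resp-↭ (↭-sym (sort-↭ vs)) (complete u))
      (Linked⇒AllPairs ≼-trans (sort-↗ vs))

Rank : Set
Rank = ℕ × ℕ × ℕ

RankOrder : StrictTotalOrder 0ℓ 0ℓ 0ℓ
RankOrder = ×-strictTotalOrder ℕₚ.<-strictTotalOrder
              (×-strictTotalOrder ℕₚ.<-strictTotalOrder ℕₚ.<-strictTotalOrder)

_≺_ : Rank → Rank → Set
_≺_ = StrictTotalOrder._<_ RankOrder

by-block : ∀ {b b′ l l′ o o′} → b ℕ.< b′ → (b , l , o) ≺ (b′ , l′ , o′)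
by-block = inj₁

by-level : ∀ {b l l′ o o′} → l ℕ.< l′ → (b , l , o) ≺ (b , l′ , o′)
by-level l<l′ = inj₂ (refl , inj₁ l<l′)

by-offset : ∀ {b l o o′} → o ℕ.< o′ → (b , l , o) ≺ (b , l , o′)
by-offset o<o′ = inj₂ (refl , inj₂ (refl , o<o′))

module _ {V : Set} (Adj : V → V → Set) where

  IsClique : ∀ {n} → (Fin n → V) → Set
  IsClique K = ∀ i j → i ≢ j → Adj (K i) (K j)

  ◂-clique : ∀ {n u} {K : Fin n → V} → (∀ {v w} → Adj v w → Adj w v) → (∀ i → Adj u (K i)) →
             IsClique K → IsClique (u ◂ K)
  ◂-clique symmetric u~K clique Fin.zero Fin.zero 0≢0 = ⊥-elim (0≢0 refl)
  ◂-clique symmetric u~K clique Fin.zero (Fin.suc j) _ = u~K j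
  ◂-clique symmetric u~K clique (Fin.suc i) Fin.zero _ = symmetric (u~K i)
  ◂-clique symmetric u~K clique (Fin.suc i) (Fin.suc j) i≢j = clique i j (i≢j ∘ cong Fin.suc)

  clique-injective : ∀ {m n} {c : V → Fin m} {K : Fin n → V} →
                     Proper Adj c → IsClique K → Injective _≡_ _≡_ (c ∘ K)
  clique-injective proper clique {i} {j} e with i ≟ j
  ... | yes i≡j = i≡j
  ... | no i≢j = ⊥-elim (proper _ _ (clique i j i≢j) e)

  clique-bound : ∀ {m n} {K : Fin n → V} → IsClique K → Colorable Adj m → n ≤ m
  clique-bound clique (c , proper) = injective⇒≤ (clique-injective proper clique)

  common-neighbours-agree : ∀ {m} {c : V → Fin (suc m)} {K : Fin m → V} → Proper Adj c → IsClique K →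
                            ∀ {u w} → (∀ i → Adj u (K i)) → (∀ i → Adj w (K i)) → c u ≡ c w
  common-neighbours-agree {c = c} {K} proper clique {u} {w} u~K w~K with c u ≟ c w
  ... | yes same = same
  ... | no different = ⊥-elim (ℕₚ.1+n≰n (injective⇒≤ three-sources))
    where
    three-sources : Injective _≡_ _≡_ (c u ◂ c w ◂ c ∘ K)
    three-sources = ◂-injective (λ { Fin.zero → different ; (Fin.suc i) → proper u (K i) (u~K i) })
                      (◂-injective (λ i → proper w (K i) (w~K i)) (clique-injective proper clique))

module Palette {n : ℕ} (a b : Fin (suc (suc n))) (a≢b : a ≢ b) where

  a⁻ : Fin (suc n)
  a⁻ = punchOut (a≢b ∘ sym)

  a⁻-lifts : punchIn b a⁻ ≡ a
  a⁻-lifts = punchIn-punchOut (a≢b ∘ sym)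

  colourQ : Fin (suc n) → Fin (suc (suc n))
  colourQ = punchIn b

  colourP : Fin n → Fin (suc (suc n))
  colourP i = punchIn b (punchIn a⁻ i)

  colourQ≢b : ∀ i → colourQ i ≢ b
  colourQ≢b = punchInᵢ≢i b

  colourP≢b : ∀ i → colourP i ≢ b
  colourP≢b i = punchInᵢ≢i b (punchIn a⁻ i)

  colourP≢a : ∀ i → colourP i ≢ a
  colourP≢a i e = punchInᵢ≢i a⁻ i (punchIn-injective b _ _ (trans e (sym a⁻-lifts)))

  colourQ-injective : Injective _≡_ _≡_ colourQ
  colourQ-injective = punchIn-injective b _ _

  colourP-injective : Injective _≡_ _≡_ colourP
  colourP-injective e = punchIn-injective a⁻ _ _ (punchIn-injective b _ _ e)

  data QColour (f : Fin (suc (suc n))) : Set where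
    b-colour : f ≡ b → QColour f
    Q-colour : ∀ i → colourQ i ≡ f → QColour f

  q-colour : ∀ f → QColour f
  q-colour f with b ≟ f
  ... | yes b≡f = b-colour (sym b≡f)
  ... | no b≢f = Q-colour (punchOut b≢f) (punchIn-punchOut b≢f)

  data PColour (f : Fin (suc (suc n))) : Set where
    a-colour : f ≡ a → PColour f
    b-colour : f ≡ b → PColour f
    P-colour : ∀ i → colourP i ≡ f → PColour f

  p-colour : ∀ f → PColour f
  p-colour f with q-colour f
  ... | b-colour f≡b = b-colour f≡b
  ... | Q-colour g e with a⁻ ≟ g
  ...   | yes refl = a-colour (trans (sym e) a⁻-lifts)
  ...   | no a⁻≢g = P-colour (punchOut a⁻≢g) (trans (cong (punchIn b) (punchIn-punchOut a⁻≢g)) e)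

module Vertices (k : ℕ) where

  clique-vertices : List (V5 k)
  clique-vertices = map vP (allFin (k ∸ 1)) ++ map vQ (allFin k)

  all-vertices : List (V5 k)
  all-vertices = vp ∷ vx ∷ vy ∷ vz ∷ vq ∷ clique-vertices

  InClique : V5 k → Set
  InClique (vP _) = ⊤
  InClique (vQ _) = ⊤
  InClique _ = ⊥

  in-clique : ∀ {v} → v ∈ clique-vertices → InClique v
  in-clique m with ∈-++⁻ (map vP (allFin (k ∸ 1))) m
  ... | inj₁ m′ with ∈-map⁻ vP m′
  ...   | _ , _ , refl = tt
  in-clique m | inj₂ m′ with ∈-map⁻ vQ m′
  ...   | _ , _ , refl = tt

  outside-cliques : ∀ {v} → ¬ InClique v → All (v ≢_) clique-vertices
  outside-cliques v∉ = All.tabulate λ { m refl → v∉ (in-clique m) }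

  clique-vertices-unique : Unique clique-vertices
  clique-vertices-unique =
    Unique.++⁺ (Unique.map⁺ (λ { refl → refl }) (Unique.allFin⁺ (k ∸ 1)))
               (Unique.map⁺ (λ { refl → refl }) (Unique.allFin⁺ k)) P∩Q
    where
    P∩Q : ∀ {v} → ¬ (v ∈ map vP (allFin (k ∸ 1)) × v ∈ map vQ (allFin k))
    P∩Q (m₁ , m₂) with ∈-map⁻ vP m₁ | ∈-map⁻ vQ m₂
    ... | _ , _ , refl | _ , _ , ()

  all-vertices-unique : Unique all-vertices
  all-vertices-unique =
      ((λ ()) ∷ (λ ()) ∷ (λ ()) ∷ (λ ()) ∷ outside-cliques (λ ()))
    ∷ ((λ ()) ∷ (λ ()) ∷ (λ ()) ∷ outside-cliques (λ ()))
    ∷ ((λ ()) ∷ (λ ()) ∷ outside-cliques (λ ()))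
    ∷ ((λ ()) ∷ outside-cliques (λ ()))
    ∷ outside-cliques (λ ())
    ∷ clique-vertices-unique

  all-vertices-complete : ∀ v → v ∈ all-vertices
  all-vertices-complete vp = here refl
  all-vertices-complete vx = there (here refl)
  all-vertices-complete vy = there (there (here refl))
  all-vertices-complete vz = there (there (there (here refl)))
  all-vertices-complete vq = there (there (there (there (here refl))))
  all-vertices-complete (vP i) =
    there (there (there (there (there (∈-++⁺ˡ (∈-map⁺ vP (∈-allFin i)))))))
  all-vertices-complete (vQ i) =
    there (there (there (there (there (∈-++⁺ʳ _ (∈-map⁺ vQ (∈-allFin i)))))))

module Colouring {k₁ : ℕ} (a b : Fin (suc (suc k₁))) (a≢b : a ≢ b) where
  open Palette a b a≢b public

  G : V5 (suc k₁) → V5 (suc k₁) → Set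
  G = Adj5 (suc k₁)

  colour : V5 (suc k₁) → Fin (suc (suc k₁))
  colour vp = a
  colour vx = b
  colour vy = a
  colour vz = b
  colour vq = b
  colour (vP i) = colourP i
  colour (vQ i) = colourQ i

  colour-proper : Proper G colour
  colour-proper u v (inj₁ e) = edge-proper e
    where
    edge-proper : ∀ {u v} → Edge5 (suc k₁) u v → colour u ≢ colour v
    edge-proper px = a≢b
    edge-proper xy = a≢b ∘ sym
    edge-proper yz = a≢b
    edge-proper (pP i) = colourP≢a i ∘ sym
    edge-proper (xP i) = colourP≢b i ∘ sym
    edge-proper (yP i) = colourP≢a i ∘ sym
    edge-proper (zP i) = colourP≢b i ∘ sym
    edge-proper (PP i≢j) = i≢j ∘ colourP-injective
    edge-proper (QQ i≢j) = i≢j ∘ colourQ-injective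
    edge-proper (zQ i) = colourQ≢b i ∘ sym
    edge-proper (qQ i) = colourQ≢b i ∘ sym
  colour-proper u v (inj₂ e) = colour-proper v u (inj₁ e) ∘ sym

  P-adjacent : ∀ {i j} → colourP j Fin.< colourP i → G (vP i) (vP j)
  P-adjacent j<i = inj₁ (PP λ i≡j → <-irrefl (cong colourP (sym i≡j)) j<i)

  Q-adjacent : ∀ {i j} → colourQ j Fin.< colourQ i → G (vQ i) (vQ j)
  Q-adjacent j<i = inj₁ (QQ λ i≡j → <-irrefl (cong colourQ (sym i≡j)) j<i)

  open Vertices (suc k₁)

  module Ranked (rank : V5 (suc k₁) → Rank) where
    open GreedyByRank G colour RankOrder rank public

    supported-by-P : ∀ {v} → (a Fin.< colour v → Witness v a) → (b Fin.< colour v → Witness v b) →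
                     (∀ i → colourP i Fin.< colour v → EarlierNeighbour v (vP i)) →
                     ∃ (EarlierNeighbour v) → Supported v
    supported-by-P {v} witness-a witness-b witness-P first = smaller , first
      where
      smaller : ∀ f → f Fin.< colour v → Witness v f
      smaller f f<v with p-colour f
      ... | a-colour refl = witness-a f<v
      ... | b-colour refl = witness-b f<v
      ... | P-colour i refl = vP i , witness-P i f<v , refl

    supported-by-Q : ∀ {v} → (b Fin.< colour v → Witness v b) →
                     (∀ i → colourQ i Fin.< colour v → EarlierNeighbour v (vQ i)) →
                     ∃ (EarlierNeighbour v) → Supported v
    supported-by-Q {v} witness-b witness-Q first = smaller , first
      where
      smaller : ∀ f → f Fin.< colour v → Witness v f
      smaller f f<v with q-colour f
      ... | b-colour refl = witness-b f<v
      ... | Q-colour i refl = vQ i , witness-Q i f<v , refl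

  module FromP-a<b (a<b : a Fin.< b) where
    rank : V5 (suc k₁) → Rank
    rank vp = 0 , 0 , 0
    rank (vP i) = 1 , toℕ (colourP i) , 0
    rank vx = 1 , toℕ b , 0
    rank vy = 1 , toℕ b , 1
    rank vz = 1 , toℕ b , 2
    rank (vQ i) = 2 , toℕ (colourQ i) , 0
    rank vq = 3 , 0 , 0
    open Ranked rank

    supported : ∀ v → v ≡ vp ⊎ Supported v
    supported vp = inj₁ refl
    supported vx = inj₂ (supported-by-P (λ _ → vp , p~x , refl) (⊥-elim ∘ <-irrefl refl)
                           (λ i c<b → inj₁ (xP i) , by-level c<b) (vp , p~x))
      where p~x = inj₂ px , by-block z<s
    supported vy = inj₂ (supported-by-P (⊥-elim ∘ <-irrefl refl) (⊥-elim ∘ <-asym a<b)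
                           (λ i c<a → inj₁ (yP i) , by-level (<-trans c<a a<b))
                           (vx , inj₂ xy , by-offset z<s))
    supported vz = inj₂ (supported-by-P (λ _ → vy , y~z , refl) (⊥-elim ∘ <-irrefl refl)
                           (λ i c<b → inj₁ (zP i) , by-level c<b) (vy , y~z))
      where y~z = inj₂ yz , by-offset (s<s z<s)
    supported vq = inj₂ (supported-by-Q (⊥-elim ∘ <-irrefl refl)
                           (λ i _ → inj₁ (qQ i) , by-block (s<s (s<s z<s)))
                           (vQ Fin.zero , inj₁ (qQ Fin.zero) , by-block (s<s (s<s z<s))))
    supported (vP i) = inj₂ (supported-by-P (λ _ → vp , p~P , refl)
                               (λ b<c → vz , (inj₂ (zP i) , by-level b<c) , refl)
                               (λ j j<i → P-adjacent j<i , by-level j<i) (vp , p~P))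
      where p~P = inj₂ (pP i) , by-block z<s
    supported (vQ i) = inj₂ (supported-by-Q (λ _ → vz , z~Q , refl)
                               (λ j j<i → Q-adjacent j<i , by-level j<i) (vz , z~Q))
      where z~Q = inj₂ (zQ i) , by-block (s<s z<s)

    greedy : ConnectedGreedyColoring G vp (greedyColour vp) greedyColour
    greedy = greedy-by-rank colour-proper vp all-vertices all-vertices-unique
                            all-vertices-complete supported

  -- the source p, with b < a: p, then P and x by colour, then z, y, then Q, then q;
  -- z needs an earlier neighbour, so P must be non-empty
  module FromP-b<a (b<a : b Fin.< a) (p₀ : Fin k₁) where
    rank : V5 (suc k₁) → Rank
    rank vp = 0 , 0 , 0
    rank (vP i) = 1 , toℕ (colourP i) , 0
    rank vx = 1 , toℕ b , 0
    rank vz = 2 , 0 , 0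
    rank vy = 2 , 0 , 1
    rank (vQ i) = 3 , toℕ (colourQ i) , 0
    rank vq = 4 , 0 , 0
    open Ranked rank

    supported : ∀ v → v ≡ vp ⊎ Supported v
    supported vp = inj₁ refl
    supported vx = inj₂ (supported-by-P (⊥-elim ∘ <-asym b<a) (⊥-elim ∘ <-irrefl refl)
                           (λ i c<b → inj₁ (xP i) , by-level c<b) (vp , inj₂ px , by-block z<s))
    supported vz = inj₂ (supported-by-P (⊥-elim ∘ <-asym b<a) (⊥-elim ∘ <-irrefl refl)
                           (λ i _ → inj₁ (zP i) , by-block (s<s z<s))
                           (vP p₀ , inj₁ (zP p₀) , by-block (s<s z<s)))
    supported vy = inj₂ (supported-by-P (⊥-elim ∘ <-irrefl refl) (λ _ → vz , z~y , refl)
                           (λ i _ → inj₁ (yP i) , by-block (s<s z<s)) (vz , z~y))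
      where z~y = inj₁ yz , by-offset z<s
    supported vq = inj₂ (supported-by-Q (⊥-elim ∘ <-irrefl refl)
                           (λ i _ → inj₁ (qQ i) , by-block (s<s (s<s (s<s z<s))))
                           (vQ Fin.zero , inj₁ (qQ Fin.zero) , by-block (s<s (s<s (s<s z<s)))))
    supported (vP i) = inj₂ (supported-by-P (λ _ → vp , p~P , refl)
                               (λ b<c → vx , (inj₂ (xP i) , by-level b<c) , refl)
                               (λ j j<i → P-adjacent j<i , by-level j<i) (vp , p~P))
      where p~P = inj₂ (pP i) , by-block z<s
    supported (vQ i) = inj₂ (supported-by-Q (λ _ → vz , z~Q , refl)
                               (λ j j<i → Q-adjacent j<i , by-level j<i) (vz , z~Q))
      where z~Q = inj₂ (zQ i) , by-block (s<s (s<s z<s))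

    greedy : ConnectedGreedyColoring G vp (greedyColour vp) greedyColour
    greedy = greedy-by-rank colour-proper vp all-vertices all-vertices-unique
                            all-vertices-complete supported

  module FromQ-a<b (a<b : a Fin.< b) where
    rank : V5 (suc k₁) → Rank
    rank vq = 0 , 0 , 0
    rank (vQ i) = 1 , toℕ (colourQ i) , 0
    rank vz = 2 , 0 , 0
    rank (vP i) = 3 , toℕ (colourP i) , 0
    rank vy = 3 , toℕ a , 0
    rank vx = 3 , toℕ b , 0
    rank vp = 4 , 0 , 0
    open Ranked rank

    supported : ∀ v → v ≡ vq ⊎ Supported v
    supported vq = inj₁ refl
    supported (vQ i) = inj₂ (supported-by-Q (λ _ → vq , q~Q , refl)
                               (λ j j<i → Q-adjacent j<i , by-level j<i) (vq , q~Q))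
      where q~Q = inj₂ (qQ i) , by-block z<s
    supported vz = inj₂ (supported-by-Q (⊥-elim ∘ <-irrefl refl)
                           (λ i _ → inj₁ (zQ i) , by-block (s<s z<s))
                           (vQ Fin.zero , inj₁ (zQ Fin.zero) , by-block (s<s z<s)))
    supported vy = inj₂ (supported-by-P (⊥-elim ∘ <-irrefl refl) (⊥-elim ∘ <-asym a<b)
                           (λ i c<a → inj₁ (yP i) , by-level c<a)
                           (vz , inj₁ yz , by-block (s<s (s<s z<s))))
    supported vx = inj₂ (supported-by-P (λ _ → vy , y~x , refl) (⊥-elim ∘ <-irrefl refl)
                           (λ i c<b → inj₁ (xP i) , by-level c<b) (vy , y~x))
      where y~x = inj₁ xy , by-level a<b
    supported vp = inj₂ (supported-by-P (⊥-elim ∘ <-irrefl refl) (⊥-elim ∘ <-asym a<b)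
                           (λ i _ → inj₁ (pP i) , by-block (s<s (s<s (s<s z<s))))
                           (vx , inj₁ px , by-block (s<s (s<s (s<s z<s)))))
    supported (vP i) = inj₂ (supported-by-P (λ a<c → vy , (inj₂ (yP i) , by-level a<c) , refl)
                               (λ b<c → vx , (inj₂ (xP i) , by-level b<c) , refl)
                               (λ j j<i → P-adjacent j<i , by-level j<i)
                               (vz , inj₂ (zP i) , by-block (s<s (s<s z<s))))

    greedy : ConnectedGreedyColoring G vq (greedyColour vq) greedyColour
    greedy = greedy-by-rank colour-proper vq all-vertices all-vertices-unique
                            all-vertices-complete supported

  module FromQ-b<a (b<a : b Fin.< a) where
    rank : V5 (suc k₁) → Rank
    rank vq = 0 , 0 , 0
    rank (vQ i) = 1 , toℕ (colourQ i) , 0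
    rank vz = 2 , 0 , 0
    rank (vP i) = 3 , toℕ (colourP i) , 0
    rank vy = 3 , toℕ a , 0
    rank vx = 3 , toℕ a , 1
    rank vp = 3 , toℕ a , 2
    open Ranked rank

    supported : ∀ v → v ≡ vq ⊎ Supported v
    supported vq = inj₁ refl
    supported (vQ i) = inj₂ (supported-by-Q (λ _ → vq , q~Q , refl)
                               (λ j j<i → Q-adjacent j<i , by-level j<i) (vq , q~Q))
      where q~Q = inj₂ (qQ i) , by-block z<s
    supported vz = inj₂ (supported-by-Q (⊥-elim ∘ <-irrefl refl)
                           (λ i _ → inj₁ (zQ i) , by-block (s<s z<s))
                           (vQ Fin.zero , inj₁ (zQ Fin.zero) , by-block (s<s z<s)))
    supported vy = inj₂ (supported-by-P (⊥-elim ∘ <-irrefl refl) (λ _ → vz , z~y , refl)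
                           (λ i c<a → inj₁ (yP i) , by-level c<a) (vz , z~y))
      where z~y = inj₁ yz , by-block (s<s (s<s z<s))
    supported vx = inj₂ (supported-by-P (⊥-elim ∘ <-asym b<a) (⊥-elim ∘ <-irrefl refl)
                           (λ i c<b → inj₁ (xP i) , by-level (<-trans c<b b<a))
                           (vy , inj₁ xy , by-offset z<s))
    supported vp = inj₂ (supported-by-P (⊥-elim ∘ <-irrefl refl) (λ _ → vx , x~p , refl)
                           (λ i c<a → inj₁ (pP i) , by-level c<a) (vx , x~p))
      where x~p = inj₁ px , by-offset (s<s z<s)
    supported (vP i) = inj₂ (supported-by-P (λ a<c → vy , (inj₂ (yP i) , by-level a<c) , refl)
                               (λ _ → vz , (inj₂ (zP i) , by-block (s<s (s<s z<s))) , refl)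
                               (λ j j<i → P-adjacent j<i , by-level j<i)
                               (vz , inj₂ (zP i) , by-block (s<s (s<s z<s))))

    greedy : ConnectedGreedyColoring G vq (greedyColour vq) greedyColour
    greedy = greedy-by-rank colour-proper vq all-vertices all-vertices-unique
                            all-vertices-complete supported

module Chromatic (k₁ : ℕ) where
  G : V5 (suc k₁) → V5 (suc k₁) → Set
  G = Adj5 (suc k₁)

  G-symmetric : ∀ {u v} → G u v → G v u
  G-symmetric = swap

  P-clique : IsClique G vP
  P-clique _ _ i≢j = inj₁ (PP i≢j)

  Q-clique : IsClique G vQ
  Q-clique _ _ i≢j = inj₁ (QQ i≢j)

  zQ-clique : IsClique G (vz ◂ vQ)
  zQ-clique = ◂-clique G G-symmetric (λ i → inj₁ (zQ i)) Q-clique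

  yP-clique : IsClique G (vy ◂ vP)
  yP-clique = ◂-clique G G-symmetric (λ i → inj₁ (yP i)) P-clique

  chromatic-number : ChromaticNumber G (suc (suc k₁))
  chromatic-number = (colour , colour-proper) , fewer-colours
    where
    open Colouring {k₁} Fin.zero (Fin.suc Fin.zero) (λ ()) using (colour; colour-proper)
    fewer-colours : ∀ m → m ℕ.< suc (suc k₁) → ¬ Colorable G m
    fewer-colours m m<k+1 colourable = ℕₚ.<⇒≱ m<k+1 (clique-bound G zQ-clique colourable)

  p≢q : ∀ (c : V5 (suc k₁) → Fin (suc (suc k₁))) → Proper G c → c vp ≢ c vq
  p≢q c proper p≡q = proper vp vx (inj₁ px) (begin
    c vp ≡⟨ p≡q ⟩
    c vq ≡⟨ common-neighbours-agree G proper Q-clique (λ i → inj₁ (qQ i)) (λ i → inj₁ (zQ i)) ⟩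
    c vz ≡⟨ common-neighbours-agree G proper yP-clique z~yP x~yP ⟩
    c vx ∎)
    where
    open ≡-Reasoning
    z~yP : ∀ i → G vz ((vy ◂ vP) i)
    z~yP Fin.zero = inj₂ yz
    z~yP (Fin.suc i) = inj₁ (zP i)
    x~yP : ∀ i → G vx ((vy ◂ vP) i)
    x~yP Fin.zero = inj₁ xy
    x~yP (Fin.suc i) = inj₁ (xP i)

-- Part (ii) for colours given as elements of Fin (k + 1), shifted by one; the argument of type
-- Fin k₁ is a vertex of P, which the ordering from p with b < a needs before z.
greedy-colourings : ∀ {k₁} → Fin k₁ → (a b : Fin (suc (suc k₁))) → a ≢ b →
  (∃ λ c → ConnectedGreedyColoring (Adj5 (suc k₁)) vp (suc (toℕ a)) c × c vq ≡ suc (toℕ b))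
  × (∃ λ c → ConnectedGreedyColoring (Adj5 (suc k₁)) vq (suc (toℕ b)) c × c vp ≡ suc (toℕ a))
greedy-colourings p₀ a b a≢b with <-cmp a b
... | tri< a<b _ _ = (_ , FromP-a<b.greedy a<b , refl) , (_ , FromQ-a<b.greedy a<b , refl)
  where open Colouring a b a≢b
... | tri≈ _ a≡b _ = ⊥-elim (a≢b a≡b)
... | tri> _ _ b<a = (_ , FromP-b<a.greedy b<a p₀ , refl) , (_ , FromQ-b<a.greedy b<a , refl)
  where open Colouring a b a≢b

as-colour : ∀ {n} α → 1 ≤ α → α ≤ n → ∃ λ (a : Fin n) → suc (toℕ a) ≡ α
as-colour (suc α) _ α<n = fromℕ< α<n , cong suc (toℕ-fromℕ< α<n)

lemma6 : (k : ℕ) → 3 ≤ k →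
    (ChromaticNumber (Adj5 k) (suc k)
    × (∀ (c : V5 k → Fin (suc k)) → Proper (Adj5 k) c → c vp ≢ c vq))
    × (∀ (α β : ℕ) → 1 ≤ α → α ≤ suc k → 1 ≤ β → β ≤ suc k → α ≢ β →
    (∃ λ c → ConnectedGreedyColoring (Adj5 k) vp α c × c vq ≡ β)
    × (∃ λ c → ConnectedGreedyColoring (Adj5 k) vq β c × c vp ≡ α))
lemma6 (suc k₁) (s≤s (s≤s (s≤s _))) =
  (Chromatic.chromatic-number k₁ , Chromatic.p≢q k₁) , greedy
  where
  greedy : ∀ α β → 1 ≤ α → α ≤ suc (suc k₁) → 1 ≤ β → β ≤ suc (suc k₁) → α ≢ β →
    (∃ λ c → ConnectedGreedyColoring (Adj5 (suc k₁)) vp α c × c vq ≡ β)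
    × (∃ λ c → ConnectedGreedyColoring (Adj5 (suc k₁)) vq β c × c vp ≡ α)
  greedy α β 1≤α α≤k+1 1≤β β≤k+1 α≢β with as-colour α 1≤α α≤k+1 | as-colour β 1≤β β≤k+1
  ... | a , refl | b , refl = greedy-colourings Fin.zero a b (α≢β ∘ cong (suc ∘ toℕ))
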